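{- Let $G$ be a finite, simple, connected graph with minimum degree $\delta(G)\geq 3$ and $L(G)\leq 2\delta(G)-1$. If there is a vertex $x\in V(G)$ with degree $2\delta(G)-1$, then $|V(G)\setminus N[x]|\leq 2$.
   Context: For a connected graph $G$, the leaf number $L(G)$ is the maximum number of leaves (vertices of degree $1$) over all spanning trees of $G$. $N[x]$ denotes the closed neighborhood of $x$, i.e. $x$ together with all vertices adjacent to $x$. -}

module Defs where

open import Data.Nat using (ℕ; _≤_; _*_; _∸_)
open import Data.Bool using (Bool; true; false; not; _∧_)
open import Data.Fin using (Fin; _≟_)
open import Data.List using (List; []; _∷_; _++_; length; filterᵇ; allFin)
open import Data.List.Relation.Unary.Linked using (Linked)
open import Data.List.Relation.Unary.Unique.Propositional using (Unique)
open import Data.Product using (Σ; _×_; ∃)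
open import Relation.Binary.PropositionalEquality using (_≡_; _≢_)
open import Relation.Nullary.Decidable using (⌊_⌋)

record Graph (n : ℕ) : Set where
  field
    adj   : Fin n → Fin n → Bool
    sym   : ∀ u v → adj u v ≡ adj v u
    irrefl : ∀ v → adj v v ≡ false
open Graph public

Adj : ∀ {n} → Graph n → Fin n → Fin n → Set
Adj G u v = adj G u v ≡ true

countV : ∀ {n} → (Fin n → Bool) → ℕ
countV {n} p = length (filterᵇ p (allFin n))

deg : ∀ {n} → Graph n → Fin n → ℕ
deg G v = countV (adj G v)

IsMinDegree : ∀ {n} → Graph n → ℕ → Set
IsMinDegree G δ = (∀ v → δ ≤ deg G v) × ∃ λ v → deg G v ≡ δ

data Reach {n} (G : Graph n) : Fin n → Fin n → Set where
  here : ∀ {v} → Reach G v v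
  step : ∀ {u w v} → Adj G u w → Reach G w v → Reach G u v

Connected : ∀ {n} → Graph n → Set
Connected {n} G = ∀ (u v : Fin n) → Reach G u v

HasCycle : ∀ {n} → Graph n → Set
HasCycle {n} G =
  Σ (Fin n) λ u → Σ (List (Fin n)) λ mid → Σ (Fin n) λ w →
    (1 ≤ length mid) ×
    Unique (u ∷ mid ++ w ∷ []) ×
    Linked (Adj G) (u ∷ mid ++ w ∷ []) ×
    Adj G w u

IsTree : ∀ {n} → Graph n → Set
IsTree G = Connected G × (HasCycle G → Data.Empty.⊥)
  where import Data.Empty

IsSpanningTree : ∀ {n} → Graph n → Graph n → Set
IsSpanningTree {n} G T = (∀ (u v : Fin n) → Adj T u v → Adj G u v) × IsTree T

leaves : ∀ {n} → Graph n → ℕ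
leaves G = countV (λ v → ⌊ deg G v Data.Nat.≟ 1 ⌋)
  where import Data.Nat

-- L(G) ≤ k : every spanning tree of G has at most k leaves
-- (equivalently, the maximum leaf number over spanning trees is ≤ k)
LeafNumber≤ : ∀ {n} → Graph n → ℕ → Set
LeafNumber≤ {n} G k = ∀ (T : Graph n) → IsSpanningTree G T → leaves T ≤ k

nonNeighbours : ∀ {n} → Graph n → Fin n → ℕ
nonNeighbours G x = countV (λ v → not ⌊ v ≟ x ⌋ ∧ not (adj G x v))

-- Suppose three vertices lie outside N[x].  The star at x is a partial spanning tree with
-- deg x = 2δ - 1 leaves.  Attaching a pendant vertex never loses a leaf, attaching one to a
-- non-leaf gains one, and any partial tree extends to a spanning tree of G in this way; so
-- no construction may reach 2δ leaves.  This rules out a neighbour of x with two neighbours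
-- outside N[x], a vertex outside N[x] adjacent to N(x) with two neighbours outside N[x], and
-- (as δ ≥ 3) any vertex at distance 3 from x.  Hence every vertex outside N[x] has at least
-- δ - 1 neighbours in N(x), and distinct such vertices have disjoint neighbourhoods in N(x);
-- three of them would need 3(δ - 1) > 2δ - 1 neighbours of x.
module Submission where

open import Defs hiding (sym)
open import Data.Nat using (ℕ; zero; suc; _+_; _*_; _∸_; _≤_; _<_; z≤n; s≤s; _≤?_)
  renaming (_≟_ to _≟ℕ_)
open import Data.Nat.Properties
  using (≤-refl; ≤-reflexive; ≤-trans; <-trans; <-irrefl; <-asym; ≤-pred; ≰⇒>; +-comm;
         +-mono-≤; +-monoʳ-≤; m+1+n≰m; suc-injective; module ≤-Reasoning)
open import Data.Nat.Tactic.RingSolver using (solve-∀)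
open import Data.Bool using (Bool; true; false; not; _∧_; _∨_; if_then_else_)
import Data.Bool as Bool
open import Data.Bool.Properties
  using (∨-comm; ∨-zeroʳ; ∨-identityʳ; ∧-zeroʳ; ∧-conicalˡ; ∧-conicalʳ)
open import Data.Fin using (Fin; zero; suc; _≟_)
import Data.Fin.Properties as Fin
open import Data.List using ([]; _∷_; _++_; length; filterᵇ; tabulate; initLast; _∷ʳ′_)
open import Data.List.Properties using (++-assoc)
open import Data.List.Relation.Unary.All using (All; []; _∷_) renaming (head to All-head)
open import Data.List.Relation.Unary.All.Properties using (++⁻ʳ)
open import Data.List.Relation.Unary.AllPairs using ([]; _∷_)
open import Data.List.Relation.Unary.Linked using (Linked; []; [-]; _∷_) renaming (tail to Linked-tail)
open import Data.List.Relation.Unary.Unique.Propositional using (Unique)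
open import Data.Product using (_×_; _,_; ∃-syntax; proj₁; proj₂)
open import Data.Sum using (_⊎_; inj₁; inj₂)
open import Data.Empty using (⊥; ⊥-elim)
open import Function using (_∘_)
open import Relation.Nullary using (yes; no; ¬_)
open import Relation.Nullary.Decidable using (⌊_⌋; toSum; _⊎-dec_; _×-dec_; ¬?; decidable-stable)
open import Relation.Unary using (Decidable)
open import Relation.Binary.PropositionalEquality

private variable n : ℕ

true≢false : true ≢ false
true≢false ()

∨-introˡ : ∀ a b → a ≡ true → a ∨ b ≡ true
∨-introˡ true b _ = refl

∨-introʳ : ∀ a b → b ≡ true → a ∨ b ≡ true
∨-introʳ true  b _ = refl
∨-introʳ false b e = e

∨-elim : ∀ a b → a ∨ b ≡ true → a ≡ true ⊎ b ≡ true
∨-elim true  b _ = inj₁ refl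
∨-elim false b e = inj₂ e

∧-intro : ∀ {a b} → a ≡ true → b ≡ true → a ∧ b ≡ true
∧-intro refl refl = refl

not-true : ∀ {b} → not b ≡ true → b ≡ false
not-true {false} _ = refl

¬true⇒false : ∀ {b} → ¬ (b ≡ true) → b ≡ false
¬true⇒false {true}  h = ⊥-elim (h refl)
¬true⇒false {false} _ = refl

_==_ : Fin n → Fin n → Bool
u == v = ⌊ u ≟ v ⌋

==-refl : (u : Fin n) → (u == u) ≡ true
==-refl u with u ≟ u
... | yes _  = refl
... | no u≢u = ⊥-elim (u≢u refl)

==⇒≡ : {u v : Fin n} → (u == v) ≡ true → u ≡ v
==⇒≡ {u = u} {v} e with u ≟ v
... | yes u≡v = u≡v

≢⇒==false : {u v : Fin n} → u ≢ v → (u == v) ≡ false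
≢⇒==false {u = u} {v} u≢v with u ≟ v
... | yes u≡v = ⊥-elim (u≢v u≡v)
... | no _    = refl

==false⇒≢ : {u v : Fin n} → (u == v) ≡ false → u ≢ v
==false⇒≢ {u = u} e refl = true≢false (trans (sym (==-refl u)) e)

==-sym : (u v : Fin n) → (u == v) ≡ (v == u)
==-sym u v with u ≟ v
... | yes refl = sym (==-refl u)
... | no u≢v   = sym (≢⇒==false (u≢v ∘ sym))

==-suc : (u v : Fin n) → (suc u == suc v) ≡ (u == v)
==-suc u v with u ≟ v
... | yes _ = refl
... | no _  = refl

b2n : Bool → ℕ
b2n true  = 1
b2n false = 0

count : (Fin n → Bool) → ℕ
count {zero}  p = 0
count {suc n} p = b2n (p zero) + count (p ∘ suc)

length-filter-tabulate : ∀ {m} k (f : Fin k → Fin m) (p : Fin m → Bool) →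
  length (filterᵇ p (tabulate f)) ≡ count (p ∘ f)
length-filter-tabulate zero    f p = refl
length-filter-tabulate (suc k) f p with p (f zero)
... | true  = cong suc (length-filter-tabulate k (f ∘ suc) p)
... | false = length-filter-tabulate k (f ∘ suc) p

countV≡count : (p : Fin n → Bool) → countV p ≡ count p
countV≡count {n} p = length-filter-tabulate n (λ i → i) p

count-cong : {p q : Fin n → Bool} → (∀ v → p v ≡ q v) → count p ≡ count q
count-cong {zero}  e = refl
count-cong {suc n} e = cong₂ _+_ (cong b2n (e zero)) (count-cong (e ∘ suc))

count-mono : {p q : Fin n → Bool} → (∀ v → p v ≡ true → q v ≡ true) → count p ≤ count q
count-mono {zero}  h = z≤n
count-mono {suc n} h = +-mono-≤ (b2n-mono (h zero)) (count-mono (h ∘ suc))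
  where
  b2n-mono : ∀ {a b} → (a ≡ true → b ≡ true) → b2n a ≤ b2n b
  b2n-mono {true}  f rewrite f refl = ≤-refl
  b2n-mono {false} f = z≤n

count-false : count {n} (λ _ → false) ≡ 0
count-false {zero}  = refl
count-false {suc n} = count-false {n}

count-== : (y : Fin n) → count (_== y) ≡ 1
count-== {suc n} zero    = cong suc (trans (count-cong {n} (λ _ → refl)) (count-false {n}))
count-== {suc n} (suc y) = trans (count-cong (λ i → ==-suc i y)) (count-== y)

interchange : ∀ a b c d → (a + b) + (c + d) ≡ (a + c) + (b + d)
interchange = solve-∀

count-∨-disjoint : (p q : Fin n → Bool) → (∀ v → p v ≡ true → q v ≡ false) →
  count (λ v → p v ∨ q v) ≡ count p + count q
count-∨-disjoint {zero}  p q d = refl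
count-∨-disjoint {suc n} p q d =
  trans (cong₂ _+_ (b2n-∨ (p zero) (q zero) (d zero)) (count-∨-disjoint (p ∘ suc) (q ∘ suc) (d ∘ suc)))
        (interchange (b2n (p zero)) (b2n (q zero)) _ _)
  where
  b2n-∨ : ∀ a b → (a ≡ true → b ≡ false) → b2n (a ∨ b) ≡ b2n a + b2n b
  b2n-∨ true  b f rewrite f refl = refl
  b2n-∨ false b f = refl

count-∨-≤ : (p q : Fin n → Bool) → count (λ v → p v ∨ q v) ≤ count p + count q
count-∨-≤ {zero}  p q = z≤n
count-∨-≤ {suc n} p q =
  ≤-trans (+-mono-≤ (b2n-∨ (p zero) (q zero)) (count-∨-≤ (p ∘ suc) (q ∘ suc)))
          (≤-reflexive (interchange (b2n (p zero)) (b2n (q zero)) _ _))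
  where
  b2n-∨ : ∀ a b → b2n (a ∨ b) ≤ b2n a + b2n b
  b2n-∨ true  b = s≤s z≤n
  b2n-∨ false b = ≤-refl

count-∨-== : (p : Fin n → Bool) (y : Fin n) → p y ≡ false →
  count (λ u → p u ∨ (u == y)) ≡ suc (count p)
count-∨-== p y py = begin
  count (λ u → p u ∨ (u == y)) ≡⟨ count-∨-disjoint p (_== y) disjoint ⟩
  count p + count (_== y)      ≡⟨ cong (count p +_) (count-== y) ⟩
  count p + 1                  ≡⟨ +-comm (count p) 1 ⟩
  suc (count p)                ∎
  where
  open ≡-Reasoning
  disjoint : ∀ u → p u ≡ true → (u == y) ≡ false
  disjoint u pu with u ≟ y
  ... | yes refl = ⊥-elim (true≢false (trans (sym pu) py))
  ... | no _     = refl

count-remove : (p : Fin n → Bool) (y : Fin n) → p y ≡ true →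
  count p ≡ suc (count (λ u → p u ∧ not (u == y)))
count-remove p y py =
  trans (count-cong split) (count-∨-== (λ u → p u ∧ not (u == y)) y p⁻y)
  where
  p⁻y : (p y ∧ not (y == y)) ≡ false
  p⁻y rewrite ==-refl y = ∧-zeroʳ (p y)
  split : ∀ u → p u ≡ ((p u ∧ not (u == y)) ∨ (u == y))
  split u with u ≟ y
  ... | yes refl rewrite py = refl
  ... | no _ with p u
  ...   | true  = refl
  ...   | false = refl

count-witness : (p : Fin n → Bool) → 1 ≤ count p → ∃[ v ] p v ≡ true
count-witness {suc n} p h with p zero in e
... | true  = zero , e
... | false = let v , pv = count-witness (p ∘ suc) h in suc v , pv

count≡0⇒false : (p : Fin n → Bool) → count p ≡ 0 → ∀ v → p v ≡ false
count≡0⇒false p c v = ¬true⇒false λ pv →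
  <-irrefl (sym c) (subst (1 ≤_) (sym (count-remove p v pv)) (s≤s z≤n))

count≥2⇒distinct : (p : Fin n → Bool) → 2 ≤ count p →
  ∃[ a ] ∃[ b ] a ≢ b × p a ≡ true × p b ≡ true
count≥2⇒distinct p h with count-witness p (≤-trans (s≤s z≤n) h)
... | a , pa with count-witness (λ u → p u ∧ not (u == a)) (≤-pred (subst (2 ≤_) (count-remove p a pa) h))
... | b , pb = a , b , (==false⇒≢ (not-true (∧-conicalʳ (p b) _ pb)) ∘ sym) , pa , ∧-conicalˡ (p b) _ pb

count≥3⇒distinct : (p : Fin n → Bool) → 3 ≤ count p →
  ∃[ a ] ∃[ b ] ∃[ c ] a ≢ b × a ≢ c × b ≢ c × p a ≡ true × p b ≡ true × p c ≡ true
count≥3⇒distinct p h =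
  let a , pa = count-witness p (≤-trans (s≤s z≤n) h)
      ≢a : ∀ {u} → (p u ∧ not (u == a)) ≡ true → u ≢ a
      ≢a {u} e = ==false⇒≢ (not-true (∧-conicalʳ (p u) _ e))
      b , c , b≢c , pb , pc =
        count≥2⇒distinct (λ u → p u ∧ not (u == a)) (≤-pred (subst (3 ≤_) (count-remove p a pa) h))
  in  a , b , c , ≢a pb ∘ sym , ≢a pc ∘ sym , b≢c , pa , ∧-conicalˡ (p b) _ pb , ∧-conicalˡ (p c) _ pc

count-mono-exchange : (p q : Fin n → Bool) (y z : Fin n) →
  (∀ v → p v ≡ true → q v ≡ true ⊎ v ≡ z) → q y ≡ true → p y ≡ false → count p ≤ count q
count-mono-exchange p q y z h qy py = begin
  count p                               ≤⟨ count-mono into ⟩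
  count (λ v → q⁻ v ∨ (v == z))         ≤⟨ count-∨-≤ q⁻ (_== z) ⟩
  count q⁻ + count (_== z)              ≡⟨ cong (count q⁻ +_) (count-== z) ⟩
  count q⁻ + 1                          ≡⟨ +-comm (count q⁻) 1 ⟩
  suc (count q⁻)                        ≡⟨ count-remove q y qy ⟨
  count q                               ∎
  where
  open ≤-Reasoning
  q⁻ = λ u → q u ∧ not (u == y)
  into : ∀ v → p v ≡ true → (q⁻ v ∨ (v == z)) ≡ true
  into v pv with h v pv
  ... | inj₂ refl = ∨-introʳ (q⁻ v) _ (==-refl v)
  ... | inj₁ qv   = ∨-introˡ (q⁻ v) _ (∧-intro qv (cong not (≢⇒==false v≢y)))
    where
    v≢y : v ≢ y
    v≢y refl = true≢false (trans (sym pv) py)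

count-mono-strict : (p q : Fin n → Bool) (y : Fin n) →
  (∀ v → p v ≡ true → q v ≡ true) → q y ≡ true → p y ≡ false → suc (count p) ≤ count q
count-mono-strict p q y h qy py =
  ≤-trans (s≤s (count-mono into)) (≤-reflexive (sym (count-remove q y qy)))
  where
  into : ∀ v → p v ≡ true → (q v ∧ not (v == y)) ≡ true
  into v pv = ∧-intro (h v pv) (cong not (≢⇒==false v≢y))
    where
    v≢y : v ≢ y
    v≢y refl = true≢false (trans (sym pv) py)

count-besides : (p : Fin n → Bool) (w : Fin n) → count p ≤ suc (count (λ u → p u ∧ not (u == w)))
count-besides p w = begin
  count p                           ≤⟨ count-mono split ⟩
  count (λ u → p⁻ u ∨ (u == w))     ≤⟨ count-∨-≤ p⁻ (_== w) ⟩
  count p⁻ + count (_== w)          ≡⟨ cong (count p⁻ +_) (count-== w) ⟩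
  count p⁻ + 1                      ≡⟨ +-comm (count p⁻) 1 ⟩
  suc (count p⁻)                    ∎
  where
  open ≤-Reasoning
  p⁻ : Fin _ → Bool
  p⁻ u = p u ∧ not (u == w)
  split : ∀ u → p u ≡ true → (p⁻ u ∨ (u == w)) ≡ true
  split u pu with toSum (u ≟ w)
  ... | inj₁ refl = ∨-introʳ (p⁻ u) _ (==-refl u)
  ... | inj₂ u≢w  = ∨-introˡ (p⁻ u) _ (∧-intro pu (cong not (≢⇒==false u≢w)))

two-neighbours-besides : (G : Graph n) {v : Fin n} (w : Fin n) → 3 ≤ deg G v →
  ∃[ q₁ ] ∃[ q₂ ] q₁ ≢ q₂ × q₁ ≢ w × q₂ ≢ w × Adj G v q₁ × Adj G v q₂
two-neighbours-besides G {v} w 3≤deg = repackage (count≥2⇒distinct others at-least-two)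
  where
  others : Fin _ → Bool
  others u = adj G v u ∧ not (u == w)
  at-least-two : 2 ≤ count others
  at-least-two = ≤-pred (≤-trans 3≤deg (≤-trans (≤-reflexive (countV≡count (adj G v))) (count-besides (adj G v) w)))
  besides : ∀ {u} → others u ≡ true → u ≢ w
  besides {u} o = ==false⇒≢ (not-true (∧-conicalʳ (adj G v u) _ o))
  repackage : (∃[ a ] ∃[ b ] a ≢ b × others a ≡ true × others b ≡ true) →
    ∃[ q₁ ] ∃[ q₂ ] q₁ ≢ q₂ × q₁ ≢ w × q₂ ≢ w × Adj G v q₁ × Adj G v q₂
  repackage (q₁ , q₂ , q₁≢q₂ , o₁ , o₂) =
    q₁ , q₂ , q₁≢q₂ , besides o₁ , besides o₂ , ∧-conicalˡ _ _ o₁ , ∧-conicalˡ _ _ o₂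

Adj-sym : (G : Graph n) {a b : Fin n} → Adj G a b → Adj G b a
Adj-sym G {a} {b} e = trans (Graph.sym G b a) e

Adj⇒≢ : (G : Graph n) {a b : Fin n} → Adj G a b → a ≢ b
Adj⇒≢ G {a} e refl = true≢false (trans (sym e) (irrefl G a))

module _ {G : Graph n} where

  Reach-snoc : ∀ {a b c} → Reach G a b → Adj G b c → Reach G a c
  Reach-snoc here       e = step e here
  Reach-snoc (step e' r) e = step e' (Reach-snoc r e)

  Reach-sym : ∀ {a b} → Reach G a b → Reach G b a
  Reach-sym here       = here
  Reach-sym (step e r) = Reach-snoc (Reach-sym r) (Adj-sym G e)

  Reach-trans : ∀ {a b c} → Reach G a b → Reach G b c → Reach G a c
  Reach-trans here       r' = r'
  Reach-trans (step e r) r' = step e (Reach-trans r r')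

  Reach-boundary : {P : Fin n → Set} → Decidable P → ∀ {a b} → Reach G a b → P a → ¬ P b →
    ∃[ w ] ∃[ w' ] Adj G w w' × P w × ¬ P w'
  Reach-boundary P? here pa ¬pb = ⊥-elim (¬pb pa)
  Reach-boundary P? {a} (step {w = m} e r) pa ¬pb with P? m
  ... | yes pm = Reach-boundary P? r pm ¬pb
  ... | no ¬pm = a , m , e , pa , ¬pm

-- Roots are the fixed points of p.

parentGraph : (Fin n → Fin n) → Graph n
parentGraph p = record
  { adj    = λ u v → not (u == v) ∧ ((p u == v) ∨ (p v == u))
  ; sym    = λ u v → cong₂ (λ a b → not a ∧ b) (==-sym u v) (∨-comm (p u == v) (p v == u))
  ; irrefl = λ v → cong (λ a → not a ∧ ((p v == v) ∨ (p v == v))) (==-refl v)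
  }

parentGraph-adj : (p : Fin n → Fin n) {u v : Fin n} → Adj (parentGraph p) u v →
  u ≢ v × (p u ≡ v ⊎ p v ≡ u)
parentGraph-adj p {u} {v} e with u == v in u==v
... | false with ∨-elim (p u == v) (p v == u) e
...   | inj₁ h = ==false⇒≢ u==v , inj₁ (==⇒≡ h)
...   | inj₂ h = ==false⇒≢ u==v , inj₂ (==⇒≡ h)

parentGraph-parent : (p : Fin n → Fin n) {v : Fin n} → p v ≢ v → Adj (parentGraph p) v (p v)
parentGraph-parent p {v} pv≢v rewrite ≢⇒==false (pv≢v ∘ sym) | ==-refl (p v) = refl

Linked-last : ∀ {A : Set} {R : A → A → Set} xs y z → Linked R (xs ++ y ∷ z ∷ []) → R y z
Linked-last []       y z (r ∷ _) = r
Linked-last (a ∷ xs) y z l       = Linked-last xs y z (Linked-tail l)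

All-middle : ∀ {A : Set} {P : A → Set} xs y zs → All P (xs ++ y ∷ zs) → P y
All-middle xs y zs h = All-head (++⁻ʳ xs h)

-- Along a path with distinct vertices, a step down to a child can only be followed by
-- further steps down (the child has just one parent), so a cycle would have to go
-- monotonically up or down in rank all the way round.
module _ (p : Fin n → Fin n) (rk : Fin n → ℕ) (rk-parent : ∀ v → p v ≢ v → rk (p v) < rk v) where

  private
    Edge = Adj (parentGraph p)

    ChildOf : Fin n → Fin n → Set
    ChildOf s t = p t ≡ s × t ≢ s

  rank-child : ∀ {s t} → ChildOf s t → rk s < rk t
  rank-child {s} {t} (pt≡s , t≢s) =
    subst (λ q → rk q < rk t) pt≡s (rk-parent t (λ pt≡t → t≢s (trans (sym pt≡t) pt≡s)))

  descending : ∀ a b ys → Unique (a ∷ b ∷ ys) → Linked Edge (b ∷ ys) → ChildOf a b →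
    Linked ChildOf (a ∷ b ∷ ys)
  descending a b []       _ _ c = c ∷ [-]
  descending a b (c ∷ ys) ((_ ∷ a≢c ∷ _) ∷ ub) (bc ∷ l) (pb≡a , b≢a) with parentGraph-adj p bc
  ... | _   , inj₁ pb≡c = ⊥-elim (a≢c (trans (sym pb≡a) pb≡c))
  ... | b≢c , inj₂ pc≡b = (pb≡a , b≢a) ∷ descending b c ys ub l (pc≡b , b≢c ∘ sym)

  descending-rank : ∀ a xs z → Linked ChildOf (a ∷ xs ++ z ∷ []) → rk a < rk z
  descending-rank a []       z (c ∷ _) = rank-child c
  descending-rank a (b ∷ xs) z (c ∷ l) = <-trans (rank-child c) (descending-rank b xs z l)

  ascending-rank : ∀ a xs y z → Unique (a ∷ xs ++ y ∷ z ∷ []) → Linked Edge (a ∷ xs ++ y ∷ z ∷ []) →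
    ChildOf z y → rk z < rk a
  ascending-rank a [] y z ((a≢y ∷ a≢z ∷ []) ∷ _) (ay ∷ _) cy with parentGraph-adj p ay
  ... | _ , inj₁ pa≡y = <-trans (rank-child cy) (rank-child (pa≡y , a≢y))
  ... | _ , inj₂ py≡a = ⊥-elim (a≢z (trans (sym py≡a) (proj₁ cy)))
  ascending-rank a (b ∷ xs) y z uq@((a≢b ∷ _) ∷ ub) (ab ∷ l) cy with parentGraph-adj p ab
  ... | _ , inj₁ pa≡b = <-trans (ascending-rank b xs y z ub l cy) (rank-child (pa≡b , a≢b))
  ... | _ , inj₂ pb≡a =
    ⊥-elim (<-asym (rank-child cy) (rank-child (Linked-last (a ∷ b ∷ xs) y z
                              (descending a b (xs ++ y ∷ z ∷ []) uq l (pb≡a , a≢b ∘ sym)))))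

  parentGraph-acyclic : ¬ HasCycle (parentGraph p)
  parentGraph-acyclic (u , mid , w , _ , uq , lk , wu) with parentGraph-adj p wu
  parentGraph-acyclic (u , b ∷ mid , w , _ , uq@(_ ∷ (b≢later ∷ _)) , (ub ∷ l) , _) | w≢u , inj₂ pu≡w
    with parentGraph-adj p ub
  ... | _   , inj₁ pu≡b = All-middle mid w [] b≢later (trans (sym pu≡b) pu≡w)
  ... | u≢b , inj₂ pb≡u =
    <-asym (descending-rank u (b ∷ mid) w (descending u b (mid ++ w ∷ []) uq l (pb≡u , u≢b ∘ sym)))
           (rank-child (pu≡w , w≢u ∘ sym))
  parentGraph-acyclic (u , mid , w , _ , uq , lk , _) | w≢u , inj₁ pw≡u with initLast mid
  ... | ys ∷ʳ′ y =
    closing (subst (λ l → Unique (u ∷ l)) reassoc uq) (subst (λ l → Linked Edge (u ∷ l)) reassoc lk)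
    where
    reassoc : (ys ++ y ∷ []) ++ w ∷ [] ≡ ys ++ y ∷ w ∷ []
    reassoc = ++-assoc ys (y ∷ []) (w ∷ [])
    closing : Unique (u ∷ ys ++ y ∷ w ∷ []) → Linked Edge (u ∷ ys ++ y ∷ w ∷ []) → ⊥
    closing uq'@(u≢later ∷ _) lk' with parentGraph-adj p (Linked-last (u ∷ ys) y w lk')
    ... | y≢w , inj₁ py≡w = <-asym (ascending-rank u ys y w uq' lk' (py≡w , y≢w)) (rank-child (pw≡u , w≢u))
    ... | _   , inj₂ pw≡y = All-middle ys y (w ∷ []) u≢later (trans (sym pw≡u) pw≡y)

_[_↦_] : (Fin n → Fin n) → Fin n → Fin n → Fin n → Fin n
(p [ y ↦ z ]) v = if v == y then z else p v

↦-here : (p : Fin n → Fin n) (y z : Fin n) → (p [ y ↦ z ]) y ≡ z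
↦-here p y z rewrite ==-refl y = refl

↦-elsewhere : (p : Fin n → Fin n) {y z v : Fin n} → v ≢ y → (p [ y ↦ z ]) v ≡ p v
↦-elsewhere p v≢y rewrite ≢⇒==false v≢y = refl

isLeaf : Graph n → Fin n → Bool
isLeaf T v = ⌊ deg T v ≟ℕ 1 ⌋

isLeaf⇒deg≡1 : (T : Graph n) (v : Fin n) → isLeaf T v ≡ true → deg T v ≡ 1
isLeaf⇒deg≡1 T v e with deg T v ≟ℕ 1
... | yes d≡1 = d≡1

leaves≡count : (T : Graph n) → leaves T ≡ count (isLeaf T)
leaves≡count T = countV≡count (isLeaf T)

deg≡1⇒isLeaf : (T : Graph n) (v : Fin n) → deg T v ≡ 1 → isLeaf T v ≡ true
deg≡1⇒isLeaf T v e rewrite e = refl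

module FarFrom (G : Graph n) (x : Fin n) where

  Far : Fin n → Set
  Far v = v ≢ x × adj G x v ≡ false

  farᵇ : Fin n → Bool
  farᵇ v = not (v == x) ∧ not (adj G x v)

  farᵇ⇒Far : ∀ {v} → farᵇ v ≡ true → Far v
  farᵇ⇒Far {v} e = ==false⇒≢ (not-true (∧-conicalˡ _ _ e)) , not-true (∧-conicalʳ (not (v == x)) _ e)

  Far⇒farᵇ : ∀ {v} → Far v → farᵇ v ≡ true
  Far⇒farᵇ (v≢x , xv) = ∧-intro (cong not (≢⇒==false v≢x)) (cong not xv)

-- Growing a tree rooted at x inside G, one pendant vertex at a time.  A partial tree is
-- a parent function; the vertices without a parent, other than x, are not yet covered.
module Growth (G : Graph n) (x : Fin n) where

  open FarFrom G x

  InTree : (Fin n → Fin n) → Fin n → Set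
  InTree p v = v ≡ x ⊎ p v ≢ v

  record PartialTree : Set where
    field
      parent        : Fin n → Fin n
      rank          : Fin n → ℕ
      parent-edge   : ∀ v → parent v ≢ v → Adj G v (parent v)
      parent-rank   : ∀ v → parent v ≢ v → rank (parent v) < rank v
      parent-inTree : ∀ v → parent v ≢ v → InTree parent (parent v)

    forest : Graph n
    forest = parentGraph parent

  open PartialTree public

  Outside : PartialTree → Fin n → Set
  Outside t v = v ≢ x × parent t v ≡ v

  outsideᵇ : PartialTree → Fin n → Bool
  outsideᵇ t v = not (v == x) ∧ (parent t v == v)

  outsideᵇ⇒Outside : (t : PartialTree) {v : Fin n} → outsideᵇ t v ≡ true → Outside t v
  outsideᵇ⇒Outside t {v} e = ==false⇒≢ (not-true (∧-conicalˡ _ _ e)) , ==⇒≡ (∧-conicalʳ (not (v == x)) _ e)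

  InTree? : (p : Fin n → Fin n) → Decidable (InTree p)
  InTree? p v = (v ≟ x) ⊎-dec ¬? (p v ≟ v)

  ¬InTree⇒Outside : (t : PartialTree) {v : Fin n} → ¬ InTree (parent t) v → Outside t v
  ¬InTree⇒Outside t {v} h = h ∘ inj₁ , decidable-stable (parent t v ≟ v) (h ∘ inj₂)

  Outside⇒¬InTree : (t : PartialTree) {v : Fin n} → Outside t v → ¬ InTree (parent t) v
  Outside⇒¬InTree t (v≢x , _)   (inj₁ v≡x)  = v≢x v≡x
  Outside⇒¬InTree t (_ , pv≡v) (inj₂ pv≢v) = pv≢v pv≡v

  ¬outsideᵇ⇒InTree : (t : PartialTree) {v : Fin n} → outsideᵇ t v ≡ false → InTree (parent t) v
  ¬outsideᵇ⇒InTree t {v} e with v ≟ x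
  ... | yes v≡x = inj₁ v≡x
  ... | no _    = inj₂ (==false⇒≢ e)

  module Complete (t : PartialTree) (covered : ∀ v → InTree (parent t) v) where

    forest⊆G : ∀ u v → Adj (forest t) u v → Adj G u v
    forest⊆G u v e with parentGraph-adj (parent t) e
    ... | u≢v , inj₁ pu≡v = subst (Adj G u) pu≡v (parent-edge t u (λ pu≡u → u≢v (trans (sym pu≡u) pu≡v)))
    ... | u≢v , inj₂ pv≡u =
      Adj-sym G (subst (Adj G v) pv≡u (parent-edge t v (λ pv≡v → u≢v (trans (sym pv≡u) pv≡v))))

    reach-root : ∀ k v → rank t v < k → Reach (forest t) v x
    reach-root (suc k) v rk<k with parent t v ≟ v
    ... | no pv≢v = step (parentGraph-parent (parent t) pv≢v)
                         (reach-root k (parent t v) (≤-trans (parent-rank t v pv≢v) (≤-pred rk<k)))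
    ... | yes pv≡v with covered v
    ...   | inj₁ refl   = here
    ...   | inj₂ pv≢v   = ⊥-elim (pv≢v pv≡v)

    forest-connected : Connected (forest t)
    forest-connected u v = Reach-trans (reach-root (suc (rank t u)) u ≤-refl)
                                       (Reach-sym (reach-root (suc (rank t v)) v ≤-refl))

    forest-spanning : IsSpanningTree G (forest t)
    forest-spanning = forest⊆G , forest-connected , parentGraph-acyclic (parent t) (rank t) (parent-rank t)

  module Attach (t : PartialTree) {y z : Fin n} (y-out : Outside t y) (z-in : InTree (parent t) z)
                (yz : Adj G y z) where

    private
      p  = parent t
      p' = p [ y ↦ z ]
      y≢x = proj₁ y-out
      py  = proj₂ y-out

      InTree⇒≢y : ∀ {w} → InTree p w → w ≢ y
      InTree⇒≢y (inj₁ refl) refl = y≢x refl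
      InTree⇒≢y (inj₂ pw≢w) refl = pw≢w py

      z≢y : z ≢ y
      z≢y = InTree⇒≢y z-in

      childless : ∀ u → p u ≡ y → u ≡ y
      childless u pu≡y with p u ≟ u
      ... | yes pu≡u = trans (sym pu≡u) pu≡y
      ... | no pu≢u  = ⊥-elim (InTree⇒≢y (subst (InTree p) pu≡y (parent-inTree t u pu≢u)) refl)

    InTree-extend : ∀ {w} → InTree p w → InTree p' w
    InTree-extend (inj₁ w≡x)  = inj₁ w≡x
    InTree-extend (inj₂ pw≢w) =
      inj₂ (λ p'w≡w → pw≢w (trans (sym (↦-elsewhere p (InTree⇒≢y (inj₂ pw≢w)))) p'w≡w))

    private
      rank' : Fin n → ℕ
      rank' v = if v == y then suc (rank t z) else rank t v

      rank'-elsewhere : ∀ {v} → v ≢ y → rank' v ≡ rank t v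
      rank'-elsewhere v≢y rewrite ≢⇒==false v≢y = refl

      edge' : ∀ v → p' v ≢ v → Adj G v (p' v)
      edge' v p'v≢v with v ≟ y
      ... | yes refl = yz
      ... | no _     = parent-edge t v p'v≢v

      rank-decreases : ∀ v → p' v ≢ v → rank' (p' v) < rank' v
      rank-decreases v p'v≢v with v ≟ y
      ... | yes refl rewrite rank'-elsewhere z≢y = ≤-refl
      ... | no _ rewrite rank'-elsewhere (InTree⇒≢y (parent-inTree t v p'v≢v)) = parent-rank t v p'v≢v

      parent-inTree' : ∀ v → p' v ≢ v → InTree p' (p' v)
      parent-inTree' v p'v≢v with v ≟ y
      ... | yes refl = InTree-extend z-in
      ... | no _     = InTree-extend (parent-inTree t v p'v≢v)

    extended : PartialTree
    extended = record { parent = p' ; rank = rank' ; parent-edge = edge'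
                      ; parent-rank = rank-decreases ; parent-inTree = parent-inTree' }

    y-InTree : InTree p' y
    y-InTree = inj₂ (λ p'y≡y → z≢y (trans (sym (↦-here p y z)) p'y≡y))

    Outside-extend : ∀ {v} → Outside t v → v ≢ y → Outside extended v
    Outside-extend (v≢x , pv≡v) v≢y = v≢x , trans (↦-elsewhere p v≢y) pv≡v

    private
      adj-y-before : ∀ u → adj (forest t) y u ≡ false
      adj-y-before u with toSum (u ≟ y)
      ... | inj₁ refl rewrite ==-refl y = refl
      ... | inj₂ u≢y rewrite ≢⇒==false (u≢y ∘ sym) | py | ≢⇒==false (u≢y ∘ sym)
                         | ≢⇒==false (u≢y ∘ childless u) = refl

      adj-y : ∀ u → adj (forest extended) y u ≡ (u == z)
      adj-y u with toSum (u ≟ y)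
      ... | inj₁ refl rewrite ==-refl y = sym (≢⇒==false (z≢y ∘ sym))
      ... | inj₂ u≢y rewrite ≢⇒==false (u≢y ∘ sym) | ==-refl y | ≢⇒==false u≢y
                         | ≢⇒==false (u≢y ∘ childless u) = trans (∨-identityʳ _) (==-sym z u)

      adj-z : ∀ u → adj (forest extended) z u ≡ (adj (forest t) z u ∨ (u == y))
      adj-z u with toSum (u ≟ y)
      ... | inj₁ refl rewrite ≢⇒==false z≢y | ==-refl y | ==-refl z = trans (∨-zeroʳ _) (sym (∨-zeroʳ _))
      ... | inj₂ u≢y rewrite ≢⇒==false z≢y | ≢⇒==false u≢y = sym (∨-identityʳ _)

      adj-elsewhere : ∀ {v} → v ≢ y → v ≢ z → ∀ u → adj (forest extended) v u ≡ adj (forest t) v u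
      adj-elsewhere {v} v≢y v≢z u with toSum (u ≟ y)
      ... | inj₁ refl rewrite ≢⇒==false v≢y | ==-refl y | py
                           | ≢⇒==false (v≢z ∘ sym) | ≢⇒==false (v≢y ∘ sym) = refl
      ... | inj₂ u≢y rewrite ≢⇒==false v≢y | ≢⇒==false u≢y = refl

    deg-y-before : deg (forest t) y ≡ 0
    deg-y-before = trans (countV≡count (adj (forest t) y)) (trans (count-cong adj-y-before) (count-false {n}))

    deg-y : deg (forest extended) y ≡ 1
    deg-y = trans (countV≡count (adj (forest extended) y)) (trans (count-cong adj-y) (count-== z))

    deg-z : deg (forest extended) z ≡ suc (deg (forest t) z)
    deg-z = begin
      deg (forest extended) z                        ≡⟨ countV≡count (adj (forest extended) z) ⟩
      count (adj (forest extended) z)                ≡⟨ count-cong adj-z ⟩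
      count (λ u → adj (forest t) z u ∨ (u == y))    ≡⟨ count-∨-== (adj (forest t) z) y
                                                          (trans (Graph.sym (forest t) z y) (adj-y-before z)) ⟩
      suc (count (adj (forest t) z))                 ≡⟨ cong suc (countV≡count (adj (forest t) z)) ⟨
      suc (deg (forest t) z)                         ∎
      where open ≡-Reasoning

    deg-elsewhere : ∀ {v} → v ≢ y → v ≢ z → deg (forest extended) v ≡ deg (forest t) v
    deg-elsewhere {v} v≢y v≢z =
      trans (countV≡count (adj (forest extended) v))
            (trans (count-cong (adj-elsewhere v≢y v≢z)) (sym (countV≡count (adj (forest t) v))))

    private
      leaf-y : isLeaf (forest extended) y ≡ true
      leaf-y = deg≡1⇒isLeaf (forest extended) y deg-y

      not-leaf-y-before : isLeaf (forest t) y ≡ false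
      not-leaf-y-before rewrite deg-y-before = refl

      leaf-kept : ∀ v → isLeaf (forest t) v ≡ true → isLeaf (forest extended) v ≡ true ⊎ v ≡ z
      leaf-kept v leaf with toSum (v ≟ y) | toSum (v ≟ z)
      ... | inj₁ refl | _ = ⊥-elim (true≢false (trans (sym leaf) not-leaf-y-before))
      ... | inj₂ _ | inj₁ v≡z = inj₂ v≡z
      ... | inj₂ v≢y | inj₂ v≢z = inj₁ (trans (cong (λ d → ⌊ d ≟ℕ 1 ⌋) (deg-elsewhere v≢y v≢z)) leaf)

    leaves-mono : leaves (forest t) ≤ leaves (forest extended)
    leaves-mono = subst₂ _≤_ (sym (leaves≡count (forest t))) (sym (leaves≡count (forest extended)))
      (count-mono-exchange (isLeaf (forest t)) (isLeaf (forest extended)) y z leaf-kept leaf-y not-leaf-y-before)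

    leaves-grow : deg (forest t) z ≢ 1 → suc (leaves (forest t)) ≤ leaves (forest extended)
    leaves-grow deg-z≢1 =
      subst₂ (λ a b → suc a ≤ b) (sym (leaves≡count (forest t))) (sym (leaves≡count (forest extended)))
      (count-mono-strict (isLeaf (forest t)) (isLeaf (forest extended)) y leaf-kept′ leaf-y not-leaf-y-before)
      where
      leaf-kept′ : ∀ v → isLeaf (forest t) v ≡ true → isLeaf (forest extended) v ≡ true
      leaf-kept′ v leaf with leaf-kept v leaf
      ... | inj₁ leaf' = leaf'
      ... | inj₂ refl  = ⊥-elim (deg-z≢1 (isLeaf⇒deg≡1 (forest t) z leaf))

    outside-count : count (outsideᵇ t) ≡ suc (count (outsideᵇ extended))
    outside-count = trans (count-cong split) (count-∨-== (outsideᵇ extended) y y-covered)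
      where
      y-covered : outsideᵇ extended y ≡ false
      y-covered rewrite ↦-here p y z | ≢⇒==false z≢y = ∧-zeroʳ _
      split : ∀ u → outsideᵇ t u ≡ (outsideᵇ extended u ∨ (u == y))
      split u with toSum (u ≟ y)
      ... | inj₁ refl rewrite py | ==-refl u | ≢⇒==false y≢x = sym (∨-zeroʳ _)
      ... | inj₂ u≢y rewrite ≢⇒==false u≢y = sym (∨-identityʳ _)

  grow : Connected G → (t : PartialTree) → ∃[ y ] Outside t y →
    ∃[ t' ] count (outsideᵇ t) ≡ suc (count (outsideᵇ t')) × leaves (forest t) ≤ leaves (forest t')
  grow conn t (y , y-out) =
    pendant (Reach-boundary (InTree? (parent t)) (conn x y) (inj₁ refl) (Outside⇒¬InTree t y-out))
    where
    pendant : ∃[ w ] ∃[ w' ] Adj G w w' × InTree (parent t) w × ¬ InTree (parent t) w' →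
      ∃[ t' ] count (outsideᵇ t) ≡ suc (count (outsideᵇ t')) × leaves (forest t) ≤ leaves (forest t')
    pendant (w , w' , ww' , w-in , w'-out) = extended , outside-count , leaves-mono
      where open Attach t (¬InTree⇒Outside t w'-out) w-in (Adj-sym G ww')

  extend : Connected G → ∀ k (t : PartialTree) → count (outsideᵇ t) ≡ k →
    ∃[ T ] IsSpanningTree G T × leaves (forest t) ≤ leaves T
  extend conn zero t none = forest t , Complete.forest-spanning t covered , ≤-refl
    where
    covered : ∀ v → InTree (parent t) v
    covered v = ¬outsideᵇ⇒InTree t (count≡0⇒false (outsideᵇ t) none v)
  extend conn (suc k) t c =
    let y , y-out = count-witness (outsideᵇ t) (subst (1 ≤_) (sym c) (s≤s z≤n))
        t' , fewer , more = grow conn t (y , outsideᵇ⇒Outside t y-out)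
        T , spanning , more′ = extend conn k t' (suc-injective (trans (sym fewer) c))
    in  T , spanning , ≤-trans more more′

  spanningTree-extending : Connected G → (t : PartialTree) →
    ∃[ T ] IsSpanningTree G T × leaves (forest t) ≤ leaves T
  spanningTree-extending conn t = extend conn _ t refl

  starParent : Fin n → Fin n
  starParent v = if adj G x v then x else v

  starParent-neighbour : ∀ {v} → Adj G x v → starParent v ≡ x
  starParent-neighbour xv rewrite xv = refl

  starParent-other : ∀ {v} → adj G x v ≡ false → starParent v ≡ v
  starParent-other xv rewrite xv = refl

  star : PartialTree
  star = record
    { parent        = starParent
    ; rank          = λ v → if adj G x v then 1 else 0
    ; parent-edge   = edge
    ; parent-rank   = rank-drop
    ; parent-inTree = parent-root
    }
    where
    edge : ∀ v → starParent v ≢ v → Adj G v (starParent v)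
    edge v h with adj G x v in xv
    ... | true  = Adj-sym G xv
    ... | false = ⊥-elim (h refl)
    rank-drop : ∀ v → starParent v ≢ v →
      (if adj G x (starParent v) then 1 else 0) < (if adj G x v then 1 else 0)
    rank-drop v h with adj G x v
    ... | true rewrite irrefl G x = s≤s z≤n
    ... | false = ⊥-elim (h refl)
    parent-root : ∀ v → starParent v ≢ v → InTree starParent (starParent v)
    parent-root v h with adj G x v
    ... | true  = inj₁ refl
    ... | false = ⊥-elim (h refl)

  star-InTree : ∀ {a} → Adj G x a → InTree starParent a
  star-InTree {a} xa = inj₂ (λ pa≡a → Adj⇒≢ G xa (trans (sym (starParent-neighbour xa)) pa≡a))

  star-Outside : ∀ {v} → Far v → Outside star v
  star-Outside (v≢x , xv) = v≢x , starParent-other xv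

  star-deg-neighbour : ∀ {v} → Adj G x v → deg (forest star) v ≡ 1
  star-deg-neighbour {v} xv = trans (countV≡count (adj (forest star) v)) (trans (count-cong only-x) (count-== x))
    where
    v≢x : v ≢ x
    v≢x = Adj⇒≢ G xv ∘ sym
    only-x : ∀ u → adj (forest star) v u ≡ (u == x)
    only-x u with toSum (u ≟ x)
    ... | inj₁ refl rewrite starParent-neighbour xv | ≢⇒==false v≢x | ==-refl u = refl
    ... | inj₂ u≢x with adj G x u in xu
    ...   | true rewrite starParent-neighbour xv | ≢⇒==false (u≢x ∘ sym) | ≢⇒==false (v≢x ∘ sym)
                       | ≢⇒==false u≢x = ∧-zeroʳ _
    ...   | false rewrite starParent-neighbour xv | ≢⇒==false (u≢x ∘ sym) | ≢⇒==false u≢x with toSum (u ≟ v)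
    ...     | inj₁ refl rewrite ==-refl u = refl
    ...     | inj₂ u≢v rewrite ≢⇒==false u≢v = ∧-zeroʳ _

  star-leaves : deg G x ≤ leaves (forest star)
  star-leaves = subst₂ _≤_ (sym (countV≡count (adj G x))) (sym (leaves≡count (forest star)))
    (count-mono (λ v xv → deg≡1⇒isLeaf (forest star) v (star-deg-neighbour xv)))

  -- Two new pendants at a leaf: the first keeps the leaf count, the second raises it.
  attach-twice-at-leaf : (t : PartialTree) {r q₁ q₂ : Fin n} → InTree (parent t) r → deg (forest t) r ≡ 1 →
    Outside t q₁ → Outside t q₂ → q₁ ≢ q₂ → Adj G q₁ r → Adj G q₂ r →
    ∃[ t' ] suc (leaves (forest t)) ≤ leaves (forest t')
  attach-twice-at-leaf t {r} r-in r-leaf q₁-out q₂-out q₁≢q₂ q₁r q₂r =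
    A₂.extended , ≤-trans (s≤s A₁.leaves-mono) (A₂.leaves-grow r-not-leaf)
    where
    module A₁ = Attach t q₁-out r-in q₁r
    module A₂ = Attach A₁.extended (A₁.Outside-extend q₂-out (q₁≢q₂ ∘ sym)) (A₁.InTree-extend r-in) q₂r
    r-not-leaf : deg (forest A₁.extended) r ≢ 1
    r-not-leaf d rewrite A₁.deg-z | r-leaf with d
    ... | ()

three-deficits : ∀ δ a b c → 3 ≤ δ → δ ≤ a + 1 → δ ≤ b + 1 → δ ≤ c + 1 → ¬ (a + b + c ≤ 2 * δ ∸ 1)
three-deficits δ a b c (s≤s (s≤s (s≤s {n = d} _))) δ≤a+1 δ≤b+1 δ≤c+1 sum≤ =
  m+1+n≰m (2 * δ ∸ 1) (begin
    (2 * δ ∸ 1) + suc d          ≡⟨ expand d ⟨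
    (2 + d) + (2 + d) + (2 + d)  ≤⟨ +-mono-≤ (+-mono-≤ (lower δ≤a+1) (lower δ≤b+1)) (lower δ≤c+1) ⟩
    a + b + c                    ≤⟨ sum≤ ⟩
    2 * δ ∸ 1                    ∎)
  where
  open ≤-Reasoning
  expand : ∀ d → (2 + d) + (2 + d) + (2 + d) ≡ (2 + d + (3 + d + 0)) + suc d
  expand = solve-∀
  lower : ∀ {m} → 3 + d ≤ m + 1 → 2 + d ≤ m
  lower {m} h = ≤-pred (subst (3 + d ≤_) (+-comm m 1) h)

module _ (G : Graph n) (x : Fin n) (conn : Connected G) (δ : ℕ) (min-deg : ∀ v → δ ≤ deg G v)
         (δ≥3 : 3 ≤ δ) (leaf-bound : LeafNumber≤ G (2 * δ ∸ 1)) (deg-x : deg G x ≡ 2 * δ ∸ 1) where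

  open Growth G x
  open FarFrom G x

  no-tree-beyond-deg-x : (t : PartialTree) → suc (deg G x) ≤ leaves (forest t) → ⊥
  no-tree-beyond-deg-x t more with spanningTree-extending conn t
  ... | T , spanning , ≤T = <-irrefl refl
    (≤-trans more (≤-trans ≤T (subst (leaves T ≤_) (sym deg-x) (leaf-bound T spanning))))

  no-two-pendants-at-leaf : (t : PartialTree) {r q₁ q₂ : Fin n} → deg G x ≤ leaves (forest t) →
    InTree (parent t) r → deg (forest t) r ≡ 1 → Outside t q₁ → Outside t q₂ → q₁ ≢ q₂ →
    Adj G r q₁ → Adj G r q₂ → ⊥
  no-two-pendants-at-leaf t start r-in r-leaf q₁-out q₂-out q₁≢q₂ rq₁ rq₂ =
    let t' , gain = attach-twice-at-leaf t r-in r-leaf q₁-out q₂-out q₁≢q₂ (Adj-sym G rq₁) (Adj-sym G rq₂)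
    in  no-tree-beyond-deg-x t' (≤-trans (s≤s start) gain)

  -- The three configurations below each yield a spanning tree with 2δ leaves.

  no-neighbour-with-two-far-neighbours : ∀ {a r₁ r₂} → Adj G x a → Far r₁ → Far r₂ → r₁ ≢ r₂ →
    Adj G a r₁ → Adj G a r₂ → ⊥
  no-neighbour-with-two-far-neighbours xa far₁ far₂ =
    no-two-pendants-at-leaf star star-leaves (star-InTree xa) (star-deg-neighbour xa)
                            (star-Outside far₁) (star-Outside far₂)

  no-far-vertex-with-two-far-neighbours : ∀ {a r r₁ r₂} → Adj G x a → Far r → Adj G a r →
    Far r₁ → Far r₂ → r₁ ≢ r₂ → Adj G r r₁ → Adj G r r₂ → ⊥
  no-far-vertex-with-two-far-neighbours {r = r} xa far ar far₁ far₂ r₁≢r₂ rr₁ rr₂ =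
    no-two-pendants-at-leaf A.extended (≤-trans star-leaves A.leaves-mono) A.y-InTree A.deg-y
      (A.Outside-extend (star-Outside far₁) (Adj⇒≢ G rr₁ ∘ sym))
      (A.Outside-extend (star-Outside far₂) (Adj⇒≢ G rr₂ ∘ sym)) r₁≢r₂ rr₁ rr₂
    where module A = Attach star (star-Outside far) (star-InTree xa) (Adj-sym G ar)

  no-far-edge-with-two-far-neighbours : ∀ {a w w' q₁ q₂} → Adj G x a → Far w → Adj G a w →
    Far w' → Adj G w w' → Far q₁ → Far q₂ → q₁ ≢ q₂ → q₁ ≢ w → q₂ ≢ w →
    Adj G w' q₁ → Adj G w' q₂ → ⊥
  no-far-edge-with-two-far-neighbours {w = w} {w'} xa far-w aw far-w' ww' far₁ far₂ q₁≢q₂ q₁≢w q₂≢w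
                                      w'q₁ w'q₂ =
    no-two-pendants-at-leaf A₂.extended (≤-trans star-leaves (≤-trans A₁.leaves-mono A₂.leaves-mono))
      A₂.y-InTree A₂.deg-y (outside far₁ q₁≢w w'q₁) (outside far₂ q₂≢w w'q₂) q₁≢q₂ w'q₁ w'q₂
    where
    module A₁ = Attach star (star-Outside far-w) (star-InTree xa) (Adj-sym G aw)
    module A₂ = Attach A₁.extended (A₁.Outside-extend (star-Outside far-w') (Adj⇒≢ G ww' ∘ sym))
                       A₁.y-InTree (Adj-sym G ww')
    outside : ∀ {q} → Far q → q ≢ w → Adj G w' q → Outside A₂.extended q
    outside far q≢w w'q = A₂.Outside-extend (A₁.Outside-extend (star-Outside far) q≢w) (Adj⇒≢ G w'q ∘ sym)

  Near : Fin n → Set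
  Near v = v ≡ x ⊎ Adj G x v ⊎ ∃[ a ] Adj G x a × Adj G a v

  Near? : Decidable Near
  Near? v = (v ≟ x) ⊎-dec (adj G x v Bool.≟ true)
                    ⊎-dec Fin.any? (λ a → (adj G x a Bool.≟ true) ×-dec (adj G a v Bool.≟ true))

  -- w' has δ ≥ 3 neighbours, none of them near x, so the edge is the third configuration.
  no-edge-leaving-near : ∀ {w w'} → Adj G w w' → Near w → ¬ Near w' → ⊥
  no-edge-leaving-near ww' (inj₁ refl)      ¬near-w' = ¬near-w' (inj₂ (inj₁ ww'))
  no-edge-leaving-near {w} ww' (inj₂ (inj₁ xw)) ¬near-w' = ¬near-w' (inj₂ (inj₂ (w , xw , ww')))
  no-edge-leaving-near {w} {w'} ww' (inj₂ (inj₂ (a , xa , aw))) ¬near-w' =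
    let q₁ , q₂ , q₁≢q₂ , q₁≢w , q₂≢w , w'q₁ , w'q₂ =
          two-neighbours-besides G w (≤-trans δ≥3 (min-deg w'))
    in  no-far-edge-with-two-far-neighbours xa (far-nbr (Adj-sym G ww')) aw far-w' ww'
          (far-nbr w'q₁) (far-nbr w'q₂) q₁≢q₂ q₁≢w q₂≢w w'q₁ w'q₂
    where
    far-w' : Far w'
    far-w' = ¬near-w' ∘ inj₁ , ¬true⇒false (¬near-w' ∘ inj₂ ∘ inj₁)
    far-nbr : ∀ {u} → Adj G w' u → Far u
    far-nbr {u} w'u = (λ { refl → ¬near-w' (inj₂ (inj₁ (Adj-sym G w'u))) })
                    , ¬true⇒false (λ xu → ¬near-w' (inj₂ (inj₂ (u , xu , Adj-sym G w'u))))

  every-vertex-near : ∀ v → Near v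
  every-vertex-near v with Near? v
  ... | yes near = near
  ... | no ¬near with Reach-boundary Near? (conn x v) (inj₁ refl) ¬near
  ...   | w , w' , ww' , near-w , ¬near-w' = ⊥-elim (no-edge-leaving-near ww' near-w ¬near-w')

  far-has-near-neighbour : ∀ {r} → Far r → ∃[ a ] Adj G x a × Adj G a r
  far-has-near-neighbour {r} (r≢x , xr) with every-vertex-near r
  ... | inj₁ r≡x        = ⊥-elim (r≢x r≡x)
  ... | inj₂ (inj₁ xr') = ⊥-elim (true≢false (trans (sym xr') xr))
  ... | inj₂ (inj₂ a)   = a

  commonᵇ : Fin n → Fin n → Bool
  commonᵇ r u = adj G x u ∧ adj G r u

  farNeighbourᵇ : Fin n → Fin n → Bool
  farNeighbourᵇ r u = adj G r u ∧ farᵇ u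

  at-most-one-far-neighbour : ∀ {r} → Far r → count (farNeighbourᵇ r) ≤ 1
  at-most-one-far-neighbour {r} far with 2 ≤? count (farNeighbourᵇ r)
  ... | no ≱2 = ≤-pred (≰⇒> ≱2)
  ... | yes ≥2 with count≥2⇒distinct (farNeighbourᵇ r) ≥2 | far-has-near-neighbour far
  ...   | r₁ , r₂ , r₁≢r₂ , f₁ , f₂ | a , xa , ar = ⊥-elim
    (no-far-vertex-with-two-far-neighbours xa far ar
      (farᵇ⇒Far (∧-conicalʳ (adj G r r₁) _ f₁)) (farᵇ⇒Far (∧-conicalʳ (adj G r r₂) _ f₂)) r₁≢r₂
      (∧-conicalˡ _ _ f₁) (∧-conicalˡ _ _ f₂))

  far-deg-bound : ∀ {r} → Far r → δ ≤ count (commonᵇ r) + 1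
  far-deg-bound {r} far = begin
    δ                                                   ≤⟨ min-deg r ⟩
    deg G r                                             ≡⟨ countV≡count (adj G r) ⟩
    count (adj G r)                                     ≤⟨ count-mono split ⟩
    count (λ u → commonᵇ r u ∨ farNeighbourᵇ r u)       ≤⟨ count-∨-≤ (commonᵇ r) (farNeighbourᵇ r) ⟩
    count (commonᵇ r) + count (farNeighbourᵇ r)         ≤⟨ +-monoʳ-≤ (count (commonᵇ r))
                                                             (at-most-one-far-neighbour far) ⟩
    count (commonᵇ r) + 1                               ∎
    where
    open ≤-Reasoning
    split : ∀ u → adj G r u ≡ true → (commonᵇ r u ∨ farNeighbourᵇ r u) ≡ true
    split u ru with adj G x u Bool.≟ true
    ... | yes xu = ∨-introˡ (commonᵇ r u) _ (∧-intro xu ru)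
    ... | no ¬xu = ∨-introʳ (commonᵇ r u) _ (∧-intro ru (Far⇒farᵇ (u≢x , ¬true⇒false ¬xu)))
      where
      u≢x : u ≢ x
      u≢x refl = true≢false (trans (sym (Adj-sym G ru)) (proj₂ far))

  common-disjoint : ∀ {r₁ r₂} → Far r₁ → Far r₂ → r₁ ≢ r₂ →
    ∀ u → commonᵇ r₁ u ≡ true → commonᵇ r₂ u ≡ false
  common-disjoint {r₁} {r₂} far₁ far₂ r₁≢r₂ u c₁ = ¬true⇒false λ c₂ →
    no-neighbour-with-two-far-neighbours (∧-conicalˡ _ _ c₁) far₁ far₂ r₁≢r₂
      (Adj-sym G (∧-conicalʳ (adj G x u) _ c₁)) (Adj-sym G (∧-conicalʳ (adj G x u) _ c₂))

  -- Each of three far vertices has at least δ - 1 neighbours in N(x), and these sets are disjoint.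
  no-three-far-vertices : ∀ {r₁ r₂ r₃} → r₁ ≢ r₂ → r₁ ≢ r₃ → r₂ ≢ r₃ →
    Far r₁ → Far r₂ → Far r₃ → ⊥
  no-three-far-vertices {r₁} {r₂} {r₃} r₁≢r₂ r₁≢r₃ r₂≢r₃ far₁ far₂ far₃ =
    three-deficits δ (count (commonᵇ r₁)) (count (commonᵇ r₂)) (count (commonᵇ r₃)) δ≥3
      (far-deg-bound far₁) (far-deg-bound far₂) (far-deg-bound far₃) (begin
        count (commonᵇ r₁) + count (commonᵇ r₂) + count (commonᵇ r₃)  ≡⟨ union-size ⟨
        count common                                                   ≤⟨ count-mono in-N ⟩
        count (adj G x)                                                ≡⟨ countV≡count (adj G x) ⟨
        deg G x                                                        ≡⟨ deg-x ⟩
        2 * δ ∸ 1                                                      ∎)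
    where
    open ≤-Reasoning
    common : Fin n → Bool
    common u = (commonᵇ r₁ u ∨ commonᵇ r₂ u) ∨ commonᵇ r₃ u
    union-size : count common ≡ count (commonᵇ r₁) + count (commonᵇ r₂) + count (commonᵇ r₃)
    union-size = trans (count-∨-disjoint (λ u → commonᵇ r₁ u ∨ commonᵇ r₂ u) (commonᵇ r₃) disjoint₃)
                       (cong (_+ count (commonᵇ r₃)) (count-∨-disjoint (commonᵇ r₁) (commonᵇ r₂)
                                                        (common-disjoint far₁ far₂ r₁≢r₂)))
      where
      disjoint₃ : ∀ u → (commonᵇ r₁ u ∨ commonᵇ r₂ u) ≡ true → commonᵇ r₃ u ≡ false
      disjoint₃ u c with ∨-elim (commonᵇ r₁ u) _ c
      ... | inj₁ c₁ = common-disjoint far₁ far₃ r₁≢r₃ u c₁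
      ... | inj₂ c₂ = common-disjoint far₂ far₃ r₂≢r₃ u c₂
    in-N : ∀ u → common u ≡ true → adj G x u ≡ true
    in-N u c with ∨-elim (commonᵇ r₁ u ∨ commonᵇ r₂ u) _ c
    ... | inj₂ c₃ = ∧-conicalˡ _ _ c₃
    ... | inj₁ c₁₂ with ∨-elim (commonᵇ r₁ u) _ c₁₂
    ...   | inj₁ c₁ = ∧-conicalˡ _ _ c₁
    ...   | inj₂ c₂ = ∧-conicalˡ _ _ c₂

lemma14 : (n : ℕ) (G : Graph n) (δ : ℕ) →
    Connected G → IsMinDegree G δ → 3 ≤ δ →
    LeafNumber≤ G (2 * δ ∸ 1) →
    (x : Fin n) → deg G x ≡ 2 * δ ∸ 1 →
    nonNeighbours G x ≤ 2
lemma14 n G δ conn (min-deg , _) δ≥3 leaf-bound x deg-x with 3 ≤? nonNeighbours G x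
... | no ≱3 = ≤-pred (≰⇒> ≱3)
... | yes ≥3 =
  let r₁ , r₂ , r₃ , r₁≢r₂ , r₁≢r₃ , r₂≢r₃ , f₁ , f₂ , f₃ =
        count≥3⇒distinct farᵇ (subst (3 ≤_) (countV≡count farᵇ) ≥3)
  in  ⊥-elim (no-three-far-vertices G x conn δ min-deg δ≥3 leaf-bound deg-x r₁≢r₂ r₁≢r₃ r₂≢r₃
                (farᵇ⇒Far f₁) (farᵇ⇒Far f₂) (farᵇ⇒Far f₃))
  where open FarFrom G x
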